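{- Let $S$ be a solution of an instance $(G,T,p)$ of Directed Vertex Multiway Cut. For every $v\in r(S)$, either there is a set $S_v\subseteq S$ which is an important $v-T$ separator, or there is a solution $S'$ such that (1) $|S'|\le |S|$, (2) $r(S)\subsetneq r(S')$, and (3) $r(S)\cup f(S)\cup S\subseteq r(S')\cup f(S')\cup S'$.
   Context: An instance consists of a directed graph $G$, terminals $T$, distinguished vertices $V^{\infty}(G)\supseteq T$ and an integer $p$; a solution is $S\subseteq V(G)\setminus V^{\infty}(G)$ with $|S|\le p$ such that $G\setminus S$ has no directed path between distinct terminals. For disjoint nonempty $X,Y$, a set $S\subseteq V(G)\setminus(X\cup Y\cup V^{\infty}(G))$ is an $X-Y$ separator if $G\setminus S$ has no directed path from $X$ to $Y$; it is minimal if no proper subset is one. $R^{+}_{H}(X)$ is the set of vertices reachable from $X$ in $H$. A minimal $X-Y$ separator $S$ is important if there is no $X-Y$ separator $S'$ with $|S'|\le |S|$ and $R^{+}_{G\setminus S}(X)\subsetneq R^{+}_{G\setminus S'}(X)$. We write $v-T$ for $\{v\}-T$. The forward shadow $f(S)$ is the set of vertices $v$ such that $S$ is a $T-\{v\}$ separator; the reverse shadow $r(S)$ is the set of vertices $v$ such that $S$ is a $\{v\}-T$ separator. -}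

module Defs where

open import Data.Nat using (ℕ; _≤_)
open import Data.Fin using (Fin)
open import Data.Bool using (Bool; true)
open import Data.Fin.Subset using (Subset; _∈_; _∉_; _⊆_; _⊂_; ⁅_⁆; ∣_∣)
open import Data.Product using (Σ; ∃; _×_; _,_)
open import Data.Sum using (_⊎_)
open import Relation.Nullary using (¬_)
open import Relation.Binary.PropositionalEquality using (_≡_; _≢_)

Digraph : ℕ → Set
Digraph n = Fin n → Fin n → Bool

VPred : ℕ → Set₁
VPred n = Fin n → Set

module _ {n : ℕ} where

  _⊆ᵖ_ : VPred n → VPred n → Set
  P ⊆ᵖ Q = ∀ v → P v → Q v

  _⊊ᵖ_ : VPred n → VPred n → Set
  P ⊊ᵖ Q = P ⊆ᵖ Q × ∃ λ v → Q v × ¬ P v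

  _∪ᵖ_ : VPred n → VPred n → VPred n
  (P ∪ᵖ Q) v = P v ⊎ Q v

  asPred : Subset n → VPred n
  asPred S v = v ∈ S

  data Walk (G : Digraph n) (S : Subset n) : Fin n → Fin n → Set where
    here  : ∀ {x} → x ∉ S → Walk G S x x
    step  : ∀ {x y z} → x ∉ S → G x y ≡ true → Walk G S y z → Walk G S x z

  Reach : Digraph n → Subset n → Subset n → VPred n
  Reach G S X v = ∃ λ x → x ∈ X × Walk G S x v

  Disjoint : Subset n → Subset n → Set
  Disjoint A B = ∀ v → v ∈ A → v ∉ B

  Nonempty : Subset n → Set
  Nonempty A = ∃ λ v → v ∈ A

  IsSeparator : Digraph n → (Vinf S X Y : Subset n) → Set
  IsSeparator G Vinf S X Y =
    Disjoint X Y × Nonempty X × Nonempty Y ×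
    Disjoint S X × Disjoint S Y × Disjoint S Vinf ×
    (∀ x y → x ∈ X → y ∈ Y → ¬ Walk G S x y)

  IsMinimalSeparator : Digraph n → (Vinf S X Y : Subset n) → Set
  IsMinimalSeparator G Vinf S X Y =
    IsSeparator G Vinf S X Y ×
    (∀ S′ → S′ ⊂ S → ¬ IsSeparator G Vinf S′ X Y)

  IsImportantSeparator : Digraph n → (Vinf S X Y : Subset n) → Set
  IsImportantSeparator G Vinf S X Y =
    IsMinimalSeparator G Vinf S X Y ×
    (∀ S′ → IsSeparator G Vinf S′ X Y → ∣ S′ ∣ ≤ ∣ S ∣ →
       ¬ (Reach G S X ⊊ᵖ Reach G S′ X))

  IsSolution : Digraph n → (T Vinf : Subset n) → ℕ → Subset n → Set
  IsSolution G T Vinf p S =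
    Disjoint S Vinf × ∣ S ∣ ≤ p ×
    (∀ t₁ t₂ → t₁ ∈ T → t₂ ∈ T → t₁ ≢ t₂ → ¬ Walk G S t₁ t₂)

  fwdShadow : Digraph n → (T Vinf S : Subset n) → VPred n
  fwdShadow G T Vinf S v = IsSeparator G Vinf S T ⁅ v ⁆

  revShadow : Digraph n → (T Vinf S : Subset n) → VPred n
  revShadow G T Vinf S v = IsSeparator G Vinf S ⁅ v ⁆ T

module Submission where

-- Let S be a solution and v ∈ r(S), i.e. S is a v–T separator.  Shrink S to a
-- minimal v–T separator D ⊆ S.  Either D is important, or some v–T separator Z
-- with |Z| ≤ |D| reaches strictly more from v than D does.  In the latter case
-- put  S′ = (S ∖ D) ∪ (Z ∖ r(S)).  The heart of the proof is that every walk to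
-- T avoiding S′ also avoids S: at its last vertex w ∈ S we have w ∈ D ∖ Z, and
-- since D is minimal, w is reachable from v avoiding Z, so the walk continues
-- to T avoiding Z (impossible) or enters Z at a vertex of r(S) (impossible).
-- From this S′ is a solution, r(S) ⊆ r(S′), every vertex of S is in S′ or in
-- r(S′), and the first vertex of D on a v-walk avoiding Z lies in r(S′) ∖ r(S).

open import Defs
open import Data.Nat using (ℕ; suc; _≤_; _+_; _≤?_; z≤n; s≤s)
open import Data.Nat.Properties using (≤-trans; ≤-reflexive; +-suc; +-monoʳ-≤; n≤1+n; module ≤-Reasoning)
open import Data.Bool using (true) renaming (_≟_ to _≟ᵇ_)
open import Data.Fin using (Fin) renaming (_≟_ to _≟ᶠ_)
open import Data.Fin.Properties using (any?; all?)
open import Data.Fin.Subset using (Subset; _∈_; _∉_; _⊆_; _⊂_; _⊃_; ⁅_⁆; ∣_∣; _∪_; _─_; _-_; inside; outside)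
open import Data.Fin.Subset.Properties
  using (_∈?_; _⊂?_; nonempty?; anySubset?; x∈p∪q⁻; p⊆p∪q; q⊆p∪q; x∈⁅x⁆; x∈⁅y⁆⇒x≡y;
         p─q⊆p; ∣p─q∣≤∣p∣; x∈p∧x∉q⇒x∈p─q; x∈p∧x≢y⇒x∈p-y; x∈p⇒p-x⊂p; p⊂q⇒p⊆q; drop-∷-⊆)
open import Data.Fin.Subset.Induction using (Acc; acc; ⊂-wellFounded; ⊃-wellFounded)
open import Data.Vec using ([]; _∷_; here; there; tabulate)
open import Data.Vec.Properties using ([]=⇒lookup; lookup⇒[]=; lookup∘tabulate)
open import Data.Product using (∃; ∃₂; _×_; _,_; proj₁; proj₂)
open import Data.Sum using (_⊎_; inj₁; inj₂; [_,_])
open import Data.Empty using (⊥; ⊥-elim)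
open import Relation.Nullary using (¬_; Dec; yes; no; does)
open import Relation.Nullary.Decidable using (map′; dec-true; _×-dec_; _→-dec_; ¬?)
open import Relation.Unary using (Decidable)
open import Relation.Binary.PropositionalEquality using (_≡_; refl; sym; trans; cong; subst)

∣p∪q∣≤∣p∣+∣q∣ : ∀ {n} (p q : Subset n) → ∣ p ∪ q ∣ ≤ ∣ p ∣ + ∣ q ∣
∣p∪q∣≤∣p∣+∣q∣ []            []            = z≤n
∣p∪q∣≤∣p∣+∣q∣ (inside  ∷ p) (inside  ∷ q) = s≤s (≤-trans (∣p∪q∣≤∣p∣+∣q∣ p q) (+-monoʳ-≤ ∣ p ∣ (n≤1+n ∣ q ∣)))
∣p∪q∣≤∣p∣+∣q∣ (inside  ∷ p) (outside ∷ q) = s≤s (∣p∪q∣≤∣p∣+∣q∣ p q)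
∣p∪q∣≤∣p∣+∣q∣ (outside ∷ p) (inside  ∷ q) = ≤-trans (s≤s (∣p∪q∣≤∣p∣+∣q∣ p q)) (≤-reflexive (sym (+-suc ∣ p ∣ ∣ q ∣)))
∣p∪q∣≤∣p∣+∣q∣ (outside ∷ p) (outside ∷ q) = ∣p∪q∣≤∣p∣+∣q∣ p q

∣p─q∣+∣q∣≡∣p∣ : ∀ {n} (p q : Subset n) → q ⊆ p → ∣ p ─ q ∣ + ∣ q ∣ ≡ ∣ p ∣
∣p─q∣+∣q∣≡∣p∣ []            []            q⊆p = refl
∣p─q∣+∣q∣≡∣p∣ (inside  ∷ p) (inside  ∷ q) q⊆p = trans (+-suc _ _) (cong suc (∣p─q∣+∣q∣≡∣p∣ p q (drop-∷-⊆ q⊆p)))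
∣p─q∣+∣q∣≡∣p∣ (inside  ∷ p) (outside ∷ q) q⊆p = cong suc (∣p─q∣+∣q∣≡∣p∣ p q (drop-∷-⊆ q⊆p))
∣p─q∣+∣q∣≡∣p∣ (outside ∷ p) (inside  ∷ q) q⊆p with q⊆p here
... | ()
∣p─q∣+∣q∣≡∣p∣ (outside ∷ p) (outside ∷ q) q⊆p = ∣p─q∣+∣q∣≡∣p∣ p q (drop-∷-⊆ q⊆p)

x∈p─q⇒x∉q : ∀ {n} {x : Fin n} (p q : Subset n) → x ∈ p ─ q → x ∉ q
x∈p─q⇒x∉q (inside ∷ p) (outside ∷ q) here                  ()
x∈p─q⇒x∉q (_      ∷ p) (_       ∷ q) (there x∈p─q) (there x∈q) = x∈p─q⇒x∉q p q x∈p─q x∈q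

∉∪ : ∀ {n} {x : Fin n} (p q : Subset n) → x ∉ p → x ∉ q → x ∉ p ∪ q
∉∪ p q x∉p x∉q x∈p∪q = [ x∉p , x∉q ] (x∈p∪q⁻ p q x∈p∪q)

removed-element : ∀ {n} {x y : Fin n} {p : Subset n} → x ∈ p → x ∉ p - y → x ≡ y
removed-element {x = x} {y} x∈p x∉p-y with x ≟ᶠ y
... | yes x≡y = x≡y
... | no x≢y = ⊥-elim (x∉p-y (x∈p∧x≢y⇒x∈p-y x∈p x≢y))

singleton-elim : ∀ {n} {P : Fin n → Set} {u x : Fin n} → P u → x ∈ ⁅ u ⁆ → P x
singleton-elim {P = P} {u} Pu x∈⁅u⁆ = subst P (sym (x∈⁅y⁆⇒x≡y u x∈⁅u⁆)) Pu

module DecidableSubset {n : ℕ} {P : Fin n → Set} (P? : Decidable P) where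

  members : Subset n
  members = tabulate (λ x → does (P? x))

  yes-if-does : ∀ {A : Set} (a? : Dec A) → does a? ≡ true → A
  yes-if-does (yes a) _ = a
  yes-if-does (no _) ()

  members⁺ : ∀ {x} → P x → x ∈ members
  members⁺ {x} Px = lookup⇒[]= x members (trans (lookup∘tabulate _ x) (dec-true (P? x) Px))

  members⁻ : ∀ {x} → x ∈ members → P x
  members⁻ {x} x∈ = yes-if-does (P? x) (trans (sym (lookup∘tabulate _ x)) ([]=⇒lookup x∈))

⊊ᵖ? : ∀ {n} {P Q : VPred n} → Decidable P → Decidable Q → Dec (P ⊊ᵖ Q)
⊊ᵖ? P? Q? = all? (λ v → P? v →-dec Q? v) ×-dec any? (λ v → Q? v ×-dec ¬? (P? v))

module Walks {n : ℕ} (G : Digraph n) where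

  start∉ : ∀ {A a b} → Walk G A a b → a ∉ A
  start∉ (here a∉A)     = a∉A
  start∉ (step a∉A _ _) = a∉A

  end∉ : ∀ {A a b} → Walk G A a b → b ∉ A
  end∉ (here b∉A)   = b∉A
  end∉ (step _ _ w) = end∉ w

  weaken : ∀ {A B a b} → A ⊆ B → Walk G B a b → Walk G A a b
  weaken A⊆B (here a∉B)     = here (λ a∈A → a∉B (A⊆B a∈A))
  weaken A⊆B (step a∉B e w) = step (λ a∈A → a∉B (A⊆B a∈A)) e (weaken A⊆B w)

  _++_ : ∀ {A a u b} → Walk G A a u → Walk G A u b → Walk G A a b
  here _     ++ w′ = w′
  step a∉A e w ++ w′ = step a∉A e (w ++ w′)

  lastHit : ∀ {A a b} (B : Subset n) → Walk G A a b →
            Walk G (A ∪ B) a b ⊎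
            ∃ λ w → w ∈ B × w ∉ A × (w ≡ b ⊎ ∃ λ c → G w c ≡ true × Walk G (A ∪ B) c b)
  lastHit {A} B (here {x} x∉A) with x ∈? B
  ... | yes x∈B = inj₂ (x , x∈B , x∉A , inj₁ refl)
  ... | no  x∉B = inj₁ (here (∉∪ A B x∉A x∉B))
  lastHit {A} B (step {x} {y} x∉A e w) with lastHit B w
  ... | inj₂ later = inj₂ later
  ... | inj₁ w′ with x ∈? B
  ...   | yes x∈B = inj₂ (x , x∈B , x∉A , inj₂ (y , e , w′))
  ...   | no  x∉B = inj₁ (step (∉∪ A B x∉A x∉B) e w′)

  suffixFromHit : ∀ {A a b} (B : Subset n) → Walk G A a b →
                  Walk G (A ∪ B) a b ⊎ ∃ λ w → w ∈ B × Walk G A w b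
  suffixFromHit {A} B W with lastHit B W
  ... | inj₁ W′ = inj₁ W′
  ... | inj₂ (w , w∈B , w∉A , inj₁ refl) = inj₂ (w , w∈B , here w∉A)
  ... | inj₂ (w , w∈B , w∉A , inj₂ (c , e , W′)) = inj₂ (w , w∈B , step w∉A e (weaken (p⊆p∪q B) W′))

  firstHit : ∀ {A a b} (B : Subset n) → a ∉ B → Walk G A a b →
             Walk G (A ∪ B) a b ⊎
             ∃₂ λ u c → c ∈ B × c ∉ A × Walk G (A ∪ B) a u × G u c ≡ true
  firstHit {A} B a∉B (here a∉A) = inj₁ (here (∉∪ A B a∉A a∉B))
  firstHit {A} B a∉B (step {y = c} a∉A e w) with c ∈? B
  ... | yes c∈B = inj₂ (_ , c , c∈B , start∉ w , here (∉∪ A B a∉A a∉B) , e)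
  ... | no  c∉B with firstHit B c∉B w
  ...   | inj₁ w′ = inj₁ (step (∉∪ A B a∉A a∉B) e w′)
  ...   | inj₂ (u , d , d∈B , d∉A , w′ , e′) = inj₂ (u , d , d∈B , d∉A , step (∉∪ A B a∉A a∉B) e w′ , e′)

  -- Walks are decidable: a walk from x to y ≠ x leaves x for the last time along
  -- some edge x → z and then avoids A ∪ ⁅ x ⁆, a strictly larger blocked set.
  walk? : ∀ A x y → Dec (Walk G A x y)
  walk? A = decide A (⊃-wellFounded A)
    where
    decide : ∀ A → Acc _⊃_ A → ∀ x y → Dec (Walk G A x y)
    decide A (acc larger) x y with x ∈? A | x ≟ᶠ y
    ... | yes x∈A | _        = no (λ w → start∉ w x∈A)
    ... | no  x∉A | yes refl = yes (here x∉A)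
    ... | no  x∉A | no  x≢y  =
      map′ (λ (z , e , w) → step x∉A e (weaken (p⊆p∪q ⁅ x ⁆) w)) leave
           (any? λ z → (G x z ≟ᵇ true) ×-dec decide (A ∪ ⁅ x ⁆) (larger grows) z y)
      where
      grows : A ⊂ A ∪ ⁅ x ⁆
      grows = p⊆p∪q ⁅ x ⁆ , x , q⊆p∪q A ⁅ x ⁆ (x∈⁅x⁆ x) , x∉A

      leave : Walk G A x y → ∃ λ z → G x z ≡ true × Walk G (A ∪ ⁅ x ⁆) z y
      leave w with lastHit ⁅ x ⁆ w
      ... | inj₁ w′ = ⊥-elim (start∉ w′ (q⊆p∪q A ⁅ x ⁆ (x∈⁅x⁆ x)))
      ... | inj₂ (u , u∈⁅x⁆ , _ , inj₁ u≡y) = ⊥-elim (x≢y (trans (sym (x∈⁅y⁆⇒x≡y x u∈⁅x⁆)) u≡y))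
      ... | inj₂ (u , u∈⁅x⁆ , _ , inj₂ (c , e , w′)) with x∈⁅y⁆⇒x≡y x u∈⁅x⁆
      ...   | refl = c , e , w′

module Separators {n : ℕ} (G : Digraph n) (Vinf : Subset n) where
  open Walks G

  module _ {S X Y : Subset n} (sep : IsSeparator G Vinf S X Y) where

    sep-nonemptyY : Nonempty Y
    sep-nonemptyY = let (_ , _ , neY , _) = sep in neY

    sep-avoidsX : Disjoint S X
    sep-avoidsX = let (_ , _ , _ , dSX , _) = sep in dSX

    sep-blocks : ∀ x y → x ∈ X → y ∈ Y → ¬ Walk G S x y
    sep-blocks = let (_ , _ , _ , _ , _ , _ , blocks) = sep in blocks

    sep-shrink : ∀ {S′} → S′ ⊆ S → (∀ x y → x ∈ X → y ∈ Y → ¬ Walk G S′ x y) →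
                 IsSeparator G Vinf S′ X Y
    sep-shrink S′⊆S blocks′ =
      let (dXY , neX , neY , dSX , dSY , dSV , _) = sep
      in dXY , neX , neY , (λ v v∈S′ → dSX v (S′⊆S v∈S′)) , (λ v v∈S′ → dSY v (S′⊆S v∈S′)) ,
         (λ v v∈S′ → dSV v (S′⊆S v∈S′)) , blocks′

  disjoint? : (A B : Subset n) → Dec (Disjoint A B)
  disjoint? A B = all? λ v → (v ∈? A) →-dec ¬? (v ∈? B)

  separator? : ∀ S X Y → Dec (IsSeparator G Vinf S X Y)
  separator? S X Y =
    disjoint? X Y ×-dec nonempty? X ×-dec nonempty? Y ×-dec
    disjoint? S X ×-dec disjoint? S Y ×-dec disjoint? S Vinf ×-dec
    all? (λ x → all? λ y → (x ∈? X) →-dec (y ∈? Y) →-dec ¬? (walk? S x y))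

  reach? : ∀ S X → Decidable (Reach G S X)
  reach? S X v = any? λ x → (x ∈? X) ×-dec walk? S x v

  minimal-inside : ∀ {C X Y} → IsSeparator G Vinf C X Y →
                   ∃ λ D → D ⊆ C × IsMinimalSeparator G Vinf D X Y
  minimal-inside {C} = descend C (⊂-wellFounded C)
    where
    descend : ∀ {X Y} C → Acc _⊂_ C → IsSeparator G Vinf C X Y →
              ∃ λ D → D ⊆ C × IsMinimalSeparator G Vinf D X Y
    descend {X} {Y} C (acc smaller) sep with anySubset? (λ D → (D ⊂? C) ×-dec separator? D X Y)
    ... | no none = C , (λ x∈C → x∈C) , sep , λ D D⊂C sepD → none (D , D⊂C , sepD)
    ... | yes (D , D⊂C , sepD) with descend D (smaller D⊂C) sepD
    ...   | E , E⊆D , minE = E , (λ x∈E → p⊂q⇒p⊆q D⊂C (E⊆D x∈E)) , minE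

  -- Minimal separators are tight: each of their vertices is entered by an edge
  -- from a vertex reachable from X (otherwise it could be dropped).
  minimal-tight : ∀ {D X Y} → IsMinimalSeparator G Vinf D X Y →
                  ∀ {w} → w ∈ D → ∃ λ u → Reach G D X u × G u w ≡ true
  minimal-tight {D} {X} {Y} (sep , minimal) {w} w∈D
    with any? (λ x → any? λ y → (x ∈? X) ×-dec (y ∈? Y) ×-dec walk? (D - w) x y)
  ... | no none = ⊥-elim (minimal (D - w) (x∈p⇒p-x⊂p w∈D)
        (sep-shrink sep (p─q⊆p D ⁅ w ⁆) λ x y x∈X y∈Y W → none (x , y , x∈X , y∈Y , W)))
  ... | yes (x , y , x∈X , y∈Y , W) with firstHit D (λ x∈D → sep-avoidsX sep x x∈D x∈X) W
  ...   | inj₁ W′ = ⊥-elim (sep-blocks sep x y x∈X y∈Y (weaken (q⊆p∪q (D - w) D) W′))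
  ...   | inj₂ (u , c , c∈D , c∉D-w , Wxu , e) with removed-element c∈D c∉D-w
  ...     | refl = u , (x , x∈X , weaken (q⊆p∪q (D - w) D) Wxu) , e

  important-or-improvable : ∀ {D X Y} → IsMinimalSeparator G Vinf D X Y →
    IsImportantSeparator G Vinf D X Y ⊎
    ∃ λ Z → IsSeparator G Vinf Z X Y × ∣ Z ∣ ≤ ∣ D ∣ × Reach G D X ⊊ᵖ Reach G Z X
  important-or-improvable {D} {X} {Y} minD
    with anySubset? (λ Z → separator? Z X Y ×-dec (∣ Z ∣ ≤? ∣ D ∣) ×-dec ⊊ᵖ? (reach? D X) (reach? Z X))
  ... | yes improvement = inj₂ improvement
  ... | no none = inj₁ (minD , λ Z sepZ ∣Z∣≤∣D∣ D⊊Z → none (Z , sepZ , ∣Z∣≤∣D∣ , D⊊Z))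

module Shadows {n : ℕ} (G : Digraph n) (T Vinf : Subset n) (T⊆Vinf : T ⊆ Vinf) where

  avoid⇒disjointT : ∀ {S} → Disjoint S Vinf → Disjoint S T
  avoid⇒disjointT dSV v v∈S v∈T = dSV v v∈S (T⊆Vinf v∈T)

  revShadow-intro : ∀ {S u} → Nonempty T → Disjoint S Vinf → u ∉ T → u ∉ S →
                    (∀ t → t ∈ T → ¬ Walk G S u t) → revShadow G T Vinf S u
  revShadow-intro {S} {u} neT dSV u∉T u∉S stuck =
    (λ x x∈⁅u⁆ → singleton-elim {P = _∉ T} u∉T x∈⁅u⁆) , (u , x∈⁅x⁆ u) , neT ,
    (λ x x∈S x∈⁅u⁆ → singleton-elim {P = _∉ S} u∉S x∈⁅u⁆ x∈S) , avoid⇒disjointT dSV , dSV ,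
    λ x t x∈⁅u⁆ t∈T → singleton-elim {P = λ a → ¬ Walk G S a t} (stuck t t∈T) x∈⁅u⁆

  fwdShadow-intro : ∀ {S u} → Nonempty T → Disjoint S Vinf → u ∉ T → u ∉ S →
                    (∀ t → t ∈ T → ¬ Walk G S t u) → fwdShadow G T Vinf S u
  fwdShadow-intro {S} {u} neT dSV u∉T u∉S unreached =
    (λ x x∈T x∈⁅u⁆ → singleton-elim {P = _∉ T} u∉T x∈⁅u⁆ x∈T) , neT , (u , x∈⁅x⁆ u) ,
    avoid⇒disjointT dSV , (λ x x∈S x∈⁅u⁆ → singleton-elim {P = _∉ S} u∉S x∈⁅u⁆ x∈S) , dSV ,
    λ t x t∈T x∈⁅u⁆ → singleton-elim {P = λ a → ¬ Walk G S t a} (unreached t t∈T) x∈⁅u⁆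

  revShadow-notT : ∀ {S u} → revShadow G T Vinf S u → u ∉ T
  revShadow-notT {u = u} (d⁅u⁆T , _) = d⁅u⁆T u (x∈⁅x⁆ u)

  revShadow-notS : ∀ {S u} → revShadow G T Vinf S u → u ∉ S
  revShadow-notS {u = u} (_ , _ , _ , dS⁅u⁆ , _) u∈S = dS⁅u⁆ u u∈S (x∈⁅x⁆ u)

  revShadow-stuck : ∀ {S u} → revShadow G T Vinf S u → ∀ t → t ∈ T → ¬ Walk G S u t
  revShadow-stuck {u = u} (_ , _ , _ , _ , _ , _ , blocks) t t∈T = blocks u t (x∈⁅x⁆ u) t∈T

  fwdShadow-notT : ∀ {S u} → fwdShadow G T Vinf S u → u ∉ T
  fwdShadow-notT {u = u} (dT⁅u⁆ , _) u∈T = dT⁅u⁆ u u∈T (x∈⁅x⁆ u)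

  fwdShadow-unreached : ∀ {S u} → fwdShadow G T Vinf S u → ∀ t → t ∈ T → ¬ Walk G S t u
  fwdShadow-unreached {u = u} (_ , _ , _ , _ , _ , _ , blocks) t t∈T = blocks t u t∈T (x∈⁅x⁆ u)

module Exchange {n : ℕ} (G : Digraph n) (T Vinf : Subset n) (p : ℕ) (T⊆Vinf : T ⊆ Vinf)
  (S : Subset n) (solS : IsSolution G T Vinf p S)
  {X D Z : Subset n} (D⊆S : D ⊆ S) (minD : IsMinimalSeparator G Vinf D X T)
  (sepZ : IsSeparator G Vinf Z X T) (∣Z∣≤∣D∣ : ∣ Z ∣ ≤ ∣ D ∣)
  (D⊊Z : Reach G D X ⊊ᵖ Reach G Z X) where

  open Walks G
  open Separators G Vinf
  open Shadows G T Vinf T⊆Vinf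

  rS : VPred n
  rS = revShadow G T Vinf S

  module R = DecidableSubset (λ u → separator? S ⁅ u ⁆ T)

  S′ : Subset n
  S′ = (S ─ D) ∪ (Z ─ R.members)

  S∩Vinf=∅ : Disjoint S Vinf
  S∩Vinf=∅ = let (dSV , _) = solS in dSV

  S∩T=∅ : Disjoint S T
  S∩T=∅ = avoid⇒disjointT S∩Vinf=∅

  nonemptyT : Nonempty T
  nonemptyT = sep-nonemptyY sepZ

  S′⁻ : ∀ {x} → x ∈ S′ → (x ∈ S × x ∉ D) ⊎ (x ∈ Z × ¬ rS x)
  S′⁻ x∈S′ with x∈p∪q⁻ (S ─ D) (Z ─ R.members) x∈S′
  ... | inj₁ x∈S─D = inj₁ (p─q⊆p S D x∈S─D , x∈p─q⇒x∉q S D x∈S─D)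
  ... | inj₂ x∈Z─R = inj₂ (p─q⊆p Z R.members x∈Z─R , λ rx → x∈p─q⇒x∉q Z R.members x∈Z─R (R.members⁺ rx))

  S∖S′⊆D : ∀ {w} → w ∈ S → w ∉ S′ → w ∈ D
  S∖S′⊆D {w} w∈S w∉S′ with w ∈? D
  ... | yes w∈D = w∈D
  ... | no  w∉D = ⊥-elim (w∉S′ (p⊆p∪q (Z ─ R.members) (x∈p∧x∉q⇒x∈p─q w∈S w∉D)))

  Z∖S′⊆rS : ∀ {z} → z ∈ Z → z ∉ S′ → rS z
  Z∖S′⊆rS {z} z∈Z z∉S′ with z ∈? R.members
  ... | yes z∈R = R.members⁻ z∈R
  ... | no  z∉R = ⊥-elim (z∉S′ (q⊆p∪q (S ─ D) (Z ─ R.members) (x∈p∧x∉q⇒x∈p─q z∈Z z∉R)))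

  S∖S′∩Z=∅ : ∀ {w} → w ∈ S → w ∉ S′ → w ∉ Z
  S∖S′∩Z=∅ w∈S w∉S′ w∈Z = revShadow-notS (Z∖S′⊆rS w∈Z w∉S′) w∈S

  D∖Z∩S′=∅ : ∀ {w} → w ∈ D → w ∉ Z → w ∉ S′
  D∖Z∩S′=∅ w∈D w∉Z w∈S′ with S′⁻ w∈S′
  ... | inj₁ (_ , w∉D) = w∉D w∈D
  ... | inj₂ (w∈Z , _) = w∉Z w∈Z

  ∣S′∣≤∣S∣ : ∣ S′ ∣ ≤ ∣ S ∣
  ∣S′∣≤∣S∣ = begin
    ∣ S′ ∣                   ≤⟨ ∣p∪q∣≤∣p∣+∣q∣ (S ─ D) (Z ─ R.members) ⟩
    ∣ S ─ D ∣ + ∣ Z ─ R.members ∣ ≤⟨ +-monoʳ-≤ ∣ S ─ D ∣ (≤-trans (∣p─q∣≤∣p∣ Z R.members) ∣Z∣≤∣D∣) ⟩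
    ∣ S ─ D ∣ + ∣ D ∣        ≡⟨ ∣p─q∣+∣q∣≡∣p∣ S D D⊆S ⟩
    ∣ S ∣                    ∎
    where open ≤-Reasoning

  S′∩Vinf=∅ : Disjoint S′ Vinf
  S′∩Vinf=∅ x x∈S′ with S′⁻ x∈S′
  ... | inj₁ (x∈S , _) = S∩Vinf=∅ x x∈S
  ... | inj₂ (x∈Z , _) = let (_ , _ , _ , _ , _ , dZV , _) = sepZ in dZV x x∈Z

  -- Vertices of D outside Z are reachable from X avoiding Z (tightness of D
  -- and R_D(X) ⊆ R_Z(X)).
  D∖Z-reached : ∀ {w} → w ∈ D → w ∉ Z → Reach G Z X w
  D∖Z-reached w∈D w∉Z with minimal-tight minD w∈D
  ... | u , reach-u , e with proj₁ D⊊Z u reach-u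
  ...   | x , x∈X , Wxu = x , x∈X , Wxu ++ step (end∉ Wxu) e (here w∉Z)

  no-escape : ∀ {w c t} → w ∈ S → w ∉ S′ → G w c ≡ true → Walk G (S′ ∪ S) c t → t ∈ T → ⊥
  no-escape {w} {t = t} w∈S w∉S′ e Wct t∈T with D∖Z-reached (S∖S′⊆D w∈S w∉S′) (S∖S′∩Z=∅ w∈S w∉S′)
  ... | x , x∈X , Wxw with suffixFromHit Z Wct
  ...   | inj₁ Wct′ = sep-blocks sepZ x t x∈X t∈T
                        (Wxw ++ step (S∖S′∩Z=∅ w∈S w∉S′) e (weaken (q⊆p∪q (S′ ∪ S) Z) Wct′))
  ...   | inj₂ (z , z∈Z , Wzt) = revShadow-stuck (Z∖S′⊆rS z∈Z (start∉ (weaken (p⊆p∪q S) Wzt)))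
                                   t t∈T (weaken (q⊆p∪q S′ S) Wzt)

  survives : ∀ {x t} → t ∈ T → Walk G S′ x t → Walk G S x t
  survives t∈T W with lastHit S W
  ... | inj₁ W′ = weaken (q⊆p∪q S′ S) W′
  ... | inj₂ (w , w∈S , _ , inj₁ refl) = ⊥-elim (S∩T=∅ w w∈S t∈T)
  ... | inj₂ (w , w∈S , w∉S′ , inj₂ (c , e , Wct)) = ⊥-elim (no-escape w∈S w∉S′ e Wct t∈T)

  S-stuck : ∀ {w t} → w ∈ S → t ∈ T → ¬ Walk G S′ w t
  S-stuck w∈S t∈T W = start∉ (survives t∈T W) w∈S

  rS′-intro : ∀ {u} → u ∉ T → u ∉ S′ → (∀ t → t ∈ T → ¬ Walk G S′ u t) → revShadow G T Vinf S′ u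
  rS′-intro = revShadow-intro nonemptyT S′∩Vinf=∅

  S∖S′⊆rS′ : ∀ {w} → w ∈ S → w ∉ S′ → revShadow G T Vinf S′ w
  S∖S′⊆rS′ w∈S w∉S′ = rS′-intro (S∩T=∅ _ w∈S) w∉S′ (λ t t∈T → S-stuck w∈S t∈T)

  solution : IsSolution G T Vinf p S′
  solution = let (_ , ∣S∣≤p , separates) = solS in
    S′∩Vinf=∅ , ≤-trans ∣S′∣≤∣S∣ ∣S∣≤p ,
    λ t₁ t₂ t₁∈T t₂∈T t₁≢t₂ W → separates t₁ t₂ t₁∈T t₂∈T t₁≢t₂ (survives t₂∈T W)

  rS⊆rS′ : rS ⊆ᵖ revShadow G T Vinf S′
  rS⊆rS′ u ru = rS′-intro (revShadow-notT ru) u∉S′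
                  (λ t t∈T W → revShadow-stuck ru t t∈T (survives t∈T W))
    where
    u∉S′ : u ∉ S′
    u∉S′ u∈S′ with S′⁻ u∈S′
    ... | inj₁ (u∈S , _) = revShadow-notS ru u∈S
    ... | inj₂ (_ , ¬ru) = ¬ru ru

  -- The first vertex of D on a walk witnessing R_D(X) ⊊ R_Z(X) is new in r(S′).
  rS⊊rS′ : rS ⊊ᵖ revShadow G T Vinf S′
  rS⊊rS′ = rS⊆rS′ , new-vertex (proj₂ D⊊Z)
    where
    new-vertex : (∃ λ y → Reach G Z X y × ¬ Reach G D X y) →
                 ∃ λ w → revShadow G T Vinf S′ w × ¬ rS w
    new-vertex (y , (x , x∈X , Wxy) , ¬reachD-y)
      with firstHit D (λ x∈D → sep-avoidsX (proj₁ minD) x x∈D x∈X) Wxy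
    ... | inj₁ W′ = ⊥-elim (¬reachD-y (x , x∈X , weaken (q⊆p∪q Z D) W′))
    ... | inj₂ (_ , w , w∈D , w∉Z , _) =
          w , S∖S′⊆rS′ (D⊆S w∈D) (D∖Z∩S′=∅ w∈D w∉Z) , λ rw → revShadow-notS rw (D⊆S w∈D)

  shadows-covered : ((rS ∪ᵖ fwdShadow G T Vinf S) ∪ᵖ asPred S)
                    ⊆ᵖ ((revShadow G T Vinf S′ ∪ᵖ fwdShadow G T Vinf S′) ∪ᵖ asPred S′)
  shadows-covered u (inj₁ (inj₁ ru)) = inj₁ (inj₁ (rS⊆rS′ u ru))
  shadows-covered u (inj₂ u∈S) with u ∈? S′
  ... | yes u∈S′ = inj₂ u∈S′
  ... | no  u∉S′ = inj₁ (inj₁ (S∖S′⊆rS′ u∈S u∉S′))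
  shadows-covered u (inj₁ (inj₂ fu)) with u ∈? S′
  ... | yes u∈S′ = inj₂ u∈S′
  ... | no  u∉S′ with any? (λ t → (t ∈? T) ×-dec walk? S′ u t)
  ...   | no stuck = inj₁ (inj₁ (rS′-intro (fwdShadow-notT fu) u∉S′ λ t t∈T W → stuck (t , t∈T , W)))
  ...   | yes (t , t∈T , Wut) =
          inj₁ (inj₂ (fwdShadow-intro nonemptyT S′∩Vinf=∅ (fwdShadow-notT fu) u∉S′ unreached))
    where
    -- A walk from T to u avoiding S′ must pass S (u ∈ f(S)), and from there
    -- it would continue through u to t avoiding S′.
    unreached : ∀ t′ → t′ ∈ T → ¬ Walk G S′ t′ u
    unreached t′ t′∈T W with suffixFromHit S W
    ... | inj₁ W′ = fwdShadow-unreached fu t′ t′∈T (weaken (q⊆p∪q S′ S) W′)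
    ... | inj₂ (w , w∈S , Wwu) = S-stuck w∈S t∈T (Wwu ++ Wut)

lemma12 : ∀ {n} (G : Digraph n) (T Vinf : Subset n) (p : ℕ) → T ⊆ Vinf →
    (S : Subset n) → IsSolution G T Vinf p S →
    ∀ v → revShadow G T Vinf S v →
    (∃ λ Sv → Sv ⊆ S × IsImportantSeparator G Vinf Sv ⁅ v ⁆ T)
    ⊎ (∃ λ S′ → IsSolution G T Vinf p S′ × ∣ S′ ∣ ≤ ∣ S ∣ ×
         (revShadow G T Vinf S ⊊ᵖ revShadow G T Vinf S′) ×
         ((revShadow G T Vinf S ∪ᵖ fwdShadow G T Vinf S) ∪ᵖ asPred S)
           ⊆ᵖ ((revShadow G T Vinf S′ ∪ᵖ fwdShadow G T Vinf S′) ∪ᵖ asPred S′))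
lemma12 G T Vinf p T⊆Vinf S solS v v∈rS
  with Separators.minimal-inside G Vinf v∈rS
... | D , D⊆S , minD with Separators.important-or-improvable G Vinf minD
...   | inj₁ important = inj₁ (D , D⊆S , important)
...   | inj₂ (Z , sepZ , ∣Z∣≤∣D∣ , D⊊Z) =
        inj₂ (S′ , solution , ∣S′∣≤∣S∣ , rS⊊rS′ , shadows-covered)
  where open Exchange G T Vinf p T⊆Vinf S solS D⊆S minD sepZ ∣Z∣≤∣D∣ D⊊Z
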